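{- Let $(l_j)_{j\in J\cup\{j_0\}}$ be labels, pairwise distinct for distinct indices, with $J$ finite, and let $\sigma,\tau_j\in\mathbb{T}$. Then: (1) if $j_0\in J$, then $\langle l_{j_0}:\sigma\rangle+\langle l_j:\tau_j\mid j\in J\rangle=\langle l_j:\tau_j\mid j\in J\rangle$; (2) if $j_0\notin J$, then $\langle l_{j_0}:\sigma\rangle+\langle l_j:\tau_j\mid j\in J\rangle=\langle l_{j_0}:\sigma\rangle\cap\langle l_j:\tau_j\mid j\in J\rangle$.
   Context: Types $\mathbb{T}$: $\sigma::=a\mid\omega\mid\sigma\to\sigma\mid\sigma\cap\sigma\mid\rho$; record types $\mathbb{T}_R$: $\rho::=\langle\rangle\mid\langle l:\sigma\rangle\mid\rho+\rho\mid\rho\cap\rho$. Subtyping $\le$ is the least preorder with: $\sigma\le\omega$; $\omega\le\omega\to\omega$; $\sigma\cap\tau\le\sigma$; $\sigma\cap\tau\le\tau$; $\sigma\le\tau_1,\sigma\le\tau_2\Rightarrow\sigma\le\tau_1\cap\tau_2$; $(\sigma\to\tau_1)\cap(\sigma\to\tau_2)\le\sigma\to\tau_1\cap\tau_2$; $\sigma_2\le\sigma_1,\tau_1\le\tau_2\Rightarrow\sigma_1\to\tau_1\le\sigma_2\to\tau_2$; $\langle l:\sigma\rangle\le\langle\rangle$; $\langle l:\sigma\rangle\cap\langle l:\tau\rangle\le\langle l:\sigma\cap\tau\rangle$; $\sigma\le\tau\Rightarrow\langle l:\sigma\rangle\le\langle l:\tau\rangle$; and, with $=$ meaning mutual $\le$: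 $\rho+\langle\rangle=\langle\rangle+\rho=\rho$; $(\rho_1+\rho_2)+\rho_3=\rho_1+(\rho_2+\rho_3)$; $(\rho_1\cap\rho_2)+\rho_3=(\rho_1+\rho_3)\cap(\rho_2+\rho_3)$; $\langle l:\sigma\rangle+(\langle l:\tau\rangle\cap\rho)=\langle l:\tau\rangle\cap\rho$; $\langle l:\sigma\rangle+(\langle l':\tau\rangle\cap\rho)=\langle l':\tau\rangle\cap(\langle l:\sigma\rangle+\rho)$ if $l\ne l'$; $\rho_1\le\rho_2\Rightarrow\rho_1+\rho\le\rho_2+\rho$; $\rho_1=\rho_2\Rightarrow\rho+\rho_1=\rho+\rho_2$. For pairwise distinct labels, $\langle l_j:\tau_j\mid j\in J\rangle$ abbreviates $\bigcap_{j\in J}\langle l_j:\tau_j\rangle$ if $J\ne\emptyset$ and $\langle\rangle$ if $J=\emptyset$. -}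

module Defs where

open import Data.Nat using (ℕ)
open import Data.List using (List; []; _∷_)
open import Data.Product using (_×_)
open import Data.Empty using (⊥)
open import Relation.Binary.PropositionalEquality using (_≡_)

Atom : Set
Atom = ℕ

Label : Set
Label = ℕ

-- Record types are the raw terms satisfying IsRec;
-- the types of 𝕋 are those satisfying IsTy (see below).  A single
-- intersection former is used for both σ ∩ σ and ρ ∩ ρ, as in the paper.
infixr 7 _⇒_
infixl 8 _∩_
infixl 9 _+_
data Ty : Set where
  atom  : Atom → Ty
  ω     : Ty
  _⇒_   : Ty → Ty → Ty
  _∩_   : Ty → Ty → Ty
  ⟨⟩    : Ty
  ⟨_∶_⟩ : Label → Ty → Ty
  _+_   : Ty → Ty → Ty

mutual
  data IsTy : Ty → Set where
    atom : ∀ a → IsTy (atom a)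
    ω    : IsTy ω
    _⇒_  : ∀ {σ τ} → IsTy σ → IsTy τ → IsTy (σ ⇒ τ)
    _∩_  : ∀ {σ τ} → IsTy σ → IsTy τ → IsTy (σ ∩ τ)
    rec  : ∀ {ρ} → IsRec ρ → IsTy ρ

  data IsRec : Ty → Set where
    ⟨⟩    : IsRec ⟨⟩
    ⟨_∶_⟩ : ∀ l {σ} → IsTy σ → IsRec ⟨ l ∶ σ ⟩
    _+_   : ∀ {ρ₁ ρ₂} → IsRec ρ₁ → IsRec ρ₂ → IsRec (ρ₁ + ρ₂)
    _∩_   : ∀ {ρ₁ ρ₂} → IsRec ρ₁ → IsRec ρ₂ → IsRec (ρ₁ ∩ ρ₂)

-- Each axiom "A = B" contributes two constructors (A ≤ B and B ≤ A).
-- Metavariables σ, τ range over 𝕋 and ρ over 𝕋_R (well-formedness premises).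
infix 4 _≤_ _≐_
data _≤_ : Ty → Ty → Set where
  refl      : ∀ {σ} → σ ≤ σ
  trans     : ∀ {σ τ υ} → σ ≤ τ → τ ≤ υ → σ ≤ υ
  top       : ∀ {σ} → IsTy σ → σ ≤ ω
  ω≤ω⇒ω     : ω ≤ ω ⇒ ω
  ∩-lb₁     : ∀ {σ τ} → IsTy σ → IsTy τ → σ ∩ τ ≤ σ
  ∩-lb₂     : ∀ {σ τ} → IsTy σ → IsTy τ → σ ∩ τ ≤ τ
  ∩-glb     : ∀ {σ τ₁ τ₂} → σ ≤ τ₁ → σ ≤ τ₂ → σ ≤ τ₁ ∩ τ₂
  ⇒-∩       : ∀ {σ τ₁ τ₂} → IsTy σ → IsTy τ₁ → IsTy τ₂ →
              (σ ⇒ τ₁) ∩ (σ ⇒ τ₂) ≤ σ ⇒ (τ₁ ∩ τ₂)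
  ⇒-mono    : ∀ {σ₁ σ₂ τ₁ τ₂} → σ₂ ≤ σ₁ → τ₁ ≤ τ₂ → σ₁ ⇒ τ₁ ≤ σ₂ ⇒ τ₂
  fld≤⟨⟩    : ∀ {l σ} → IsTy σ → ⟨ l ∶ σ ⟩ ≤ ⟨⟩
  fld-∩     : ∀ {l σ τ} → IsTy σ → IsTy τ → ⟨ l ∶ σ ⟩ ∩ ⟨ l ∶ τ ⟩ ≤ ⟨ l ∶ σ ∩ τ ⟩
  fld-mono  : ∀ {l σ τ} → σ ≤ τ → ⟨ l ∶ σ ⟩ ≤ ⟨ l ∶ τ ⟩
  +unitʳ-≤  : ∀ {ρ} → IsRec ρ → ρ + ⟨⟩ ≤ ρ
  +unitʳ-≥  : ∀ {ρ} → IsRec ρ → ρ ≤ ρ + ⟨⟩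
  +unitˡ-≤  : ∀ {ρ} → IsRec ρ → ⟨⟩ + ρ ≤ ρ
  +unitˡ-≥  : ∀ {ρ} → IsRec ρ → ρ ≤ ⟨⟩ + ρ
  +assoc-≤  : ∀ {ρ₁ ρ₂ ρ₃} → IsRec ρ₁ → IsRec ρ₂ → IsRec ρ₃ →
              (ρ₁ + ρ₂) + ρ₃ ≤ ρ₁ + (ρ₂ + ρ₃)
  +assoc-≥  : ∀ {ρ₁ ρ₂ ρ₃} → IsRec ρ₁ → IsRec ρ₂ → IsRec ρ₃ →
              ρ₁ + (ρ₂ + ρ₃) ≤ (ρ₁ + ρ₂) + ρ₃
  ∩+-≤      : ∀ {ρ₁ ρ₂ ρ₃} → IsRec ρ₁ → IsRec ρ₂ → IsRec ρ₃ →
              (ρ₁ ∩ ρ₂) + ρ₃ ≤ (ρ₁ + ρ₃) ∩ (ρ₂ + ρ₃)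
  ∩+-≥      : ∀ {ρ₁ ρ₂ ρ₃} → IsRec ρ₁ → IsRec ρ₂ → IsRec ρ₃ →
              (ρ₁ + ρ₃) ∩ (ρ₂ + ρ₃) ≤ (ρ₁ ∩ ρ₂) + ρ₃
  ovr-same-≤ : ∀ {l σ τ ρ} → IsTy σ → IsTy τ → IsRec ρ →
               ⟨ l ∶ σ ⟩ + (⟨ l ∶ τ ⟩ ∩ ρ) ≤ ⟨ l ∶ τ ⟩ ∩ ρ
  ovr-same-≥ : ∀ {l σ τ ρ} → IsTy σ → IsTy τ → IsRec ρ →
               ⟨ l ∶ τ ⟩ ∩ ρ ≤ ⟨ l ∶ σ ⟩ + (⟨ l ∶ τ ⟩ ∩ ρ)
  ovr-diff-≤ : ∀ {l l′ σ τ ρ} → (l ≡ l′ → ⊥) → IsTy σ → IsTy τ → IsRec ρ →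
               ⟨ l ∶ σ ⟩ + (⟨ l′ ∶ τ ⟩ ∩ ρ) ≤ ⟨ l′ ∶ τ ⟩ ∩ (⟨ l ∶ σ ⟩ + ρ)
  ovr-diff-≥ : ∀ {l l′ σ τ ρ} → (l ≡ l′ → ⊥) → IsTy σ → IsTy τ → IsRec ρ →
               ⟨ l′ ∶ τ ⟩ ∩ (⟨ l ∶ σ ⟩ + ρ) ≤ ⟨ l ∶ σ ⟩ + (⟨ l′ ∶ τ ⟩ ∩ ρ)
  +-monoˡ   : ∀ {ρ₁ ρ₂ ρ} → IsRec ρ₁ → IsRec ρ₂ → IsRec ρ →
              ρ₁ ≤ ρ₂ → ρ₁ + ρ ≤ ρ₂ + ρ
  +-congʳ   : ∀ {ρ ρ₁ ρ₂} → IsRec ρ → IsRec ρ₁ → IsRec ρ₂ →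
              ρ₁ ≤ ρ₂ → ρ₂ ≤ ρ₁ → ρ + ρ₁ ≤ ρ + ρ₂

_≐_ : Ty → Ty → Set
σ ≐ τ = (σ ≤ τ) × (τ ≤ σ)

-- ⟨ l_j : τ_j | j ∈ J ⟩ for J given as a list of indices:
-- the intersection of the fields (right-nested, in list order), ⟨⟩ if J = ∅.
recType : (ℕ → Label) → (ℕ → Ty) → List ℕ → Ty
recType l τ []           = ⟨⟩
recType l τ (j ∷ [])     = ⟨ l j ∶ τ j ⟩
recType l τ (j ∷ k ∷ js) = ⟨ l j ∶ τ j ⟩ ∩ recType l τ (k ∷ js)

-- Adding a field to ⟨ l_j : τ_j | j ∈ J ⟩ is pushed through the intersection one field at a
-- time: past a field with a different label it commutes (ovr-diff), and at a field with the
-- same label it is absorbed (ovr-same).  If no label matches it reaches the end, where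
-- ⟨ l : σ ⟩ + ⟨⟩ = ⟨ l : σ ⟩ leaves it as one more conjunct.
module Submission where

open import Defs
open import Data.Nat using (ℕ; _≟_)
open import Data.List using (List; _∷_)
open import Data.List.Membership.Propositional using (_∈_; _∉_)
open import Data.List.Relation.Unary.All as All using (All; _∷_; [])
open import Data.List.Relation.Unary.Any as Any using (Any; here; there)
open import Data.List.Relation.Unary.Unique.Propositional using (Unique)
open import Data.Product using (_×_; _,_)
open import Function using (_∘_)
open import Relation.Binary.Bundles using (Setoid)
open import Relation.Nullary using (Dec; yes; no)
open import Relation.Binary.PropositionalEquality as ≡ using (_≡_; _≢_)

≐-refl : ∀ {σ} → σ ≐ σ
≐-refl = refl , refl

≐-sym : ∀ {σ τ} → σ ≐ τ → τ ≐ σ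
≐-sym (p , q) = q , p

≐-trans : ∀ {σ τ υ} → σ ≐ τ → τ ≐ υ → σ ≐ υ
≐-trans (p , q) (r , s) = trans p r , trans s q

≐-setoid : Setoid _ _
≐-setoid = record
  { Carrier = Ty
  ; _≈_ = _≐_
  ; isEquivalence = record { refl = ≐-refl ; sym = ≐-sym ; trans = ≐-trans }
  }

open import Relation.Binary.Reasoning.Setoid ≐-setoid

∩-congˡ : ∀ {σ τ τ′} → IsTy σ → IsTy τ → IsTy τ′ → τ ≐ τ′ → σ ∩ τ ≐ σ ∩ τ′
∩-congˡ S T T′ (p , q) =
  ∩-glb (∩-lb₁ S T) (trans (∩-lb₂ S T) p) , ∩-glb (∩-lb₁ S T′) (trans (∩-lb₂ S T′) q)

∩-comm : ∀ {σ τ} → IsTy σ → IsTy τ → σ ∩ τ ≐ τ ∩ σ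
∩-comm S T = ∩-glb (∩-lb₂ S T) (∩-lb₁ S T) , ∩-glb (∩-lb₂ T S) (∩-lb₁ T S)

∩-leftSwap-≤ : ∀ {σ τ υ} → IsTy σ → IsTy τ → IsTy υ → σ ∩ (τ ∩ υ) ≤ τ ∩ (σ ∩ υ)
∩-leftSwap-≤ S T U =
  ∩-glb (trans (∩-lb₂ S (T ∩ U)) (∩-lb₁ T U))
        (∩-glb (∩-lb₁ S (T ∩ U)) (trans (∩-lb₂ S (T ∩ U)) (∩-lb₂ T U)))

∩-leftSwap : ∀ {σ τ υ} → IsTy σ → IsTy τ → IsTy υ → σ ∩ (τ ∩ υ) ≐ τ ∩ (σ ∩ υ)
∩-leftSwap S T U = ∩-leftSwap-≤ S T U , ∩-leftSwap-≤ T S U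

field-∩-⟨⟩ : ∀ {l σ} → IsTy σ → ⟨ l ∶ σ ⟩ ∩ ⟨⟩ ≐ ⟨ l ∶ σ ⟩
field-∩-⟨⟩ S = ∩-lb₁ (rec ⟨ _ ∶ S ⟩) (rec ⟨⟩) , ∩-glb refl (fld≤⟨⟩ S)

+-identityʳ : ∀ {ρ} → IsRec ρ → ρ + ⟨⟩ ≐ ρ
+-identityʳ R = +unitʳ-≤ R , +unitʳ-≥ R

+-congˡ : ∀ {ρ ρ₁ ρ₂} → IsRec ρ → IsRec ρ₁ → IsRec ρ₂ → ρ₁ ≐ ρ₂ → ρ + ρ₁ ≐ ρ + ρ₂
+-congˡ R R₁ R₂ (p , q) = +-congʳ R R₁ R₂ p q , +-congʳ R R₂ R₁ q p

override-same : ∀ {l l′ σ τ ρ} → l′ ≡ l → IsTy σ → IsTy τ → IsRec ρ →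
                ⟨ l ∶ σ ⟩ + (⟨ l′ ∶ τ ⟩ ∩ ρ) ≐ ⟨ l′ ∶ τ ⟩ ∩ ρ
override-same ≡.refl S T R = ovr-same-≤ S T R , ovr-same-≥ S T R

override-diff : ∀ {l l′ σ τ ρ} → l′ ≢ l → IsTy σ → IsTy τ → IsRec ρ →
                ⟨ l ∶ σ ⟩ + (⟨ l′ ∶ τ ⟩ ∩ ρ) ≐ ⟨ l′ ∶ τ ⟩ ∩ (⟨ l ∶ σ ⟩ + ρ)
override-diff l′≢l S T R = ovr-diff-≤ l≢l′ S T R , ovr-diff-≥ l≢l′ S T R
  where l≢l′ = λ l≡l′ → l′≢l (≡.sym l≡l′)

module _ (l : ℕ → Label) (τ : ℕ → Ty) where

  recType-isRec : ∀ {J} → All (λ j → IsTy (τ j)) J → IsRec (recType l τ J)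
  recType-isRec []                = ⟨⟩
  recType-isRec (T ∷ [])          = ⟨ _ ∶ T ⟩
  recType-isRec (T ∷ Ts@(_ ∷ _))  = ⟨ _ ∶ T ⟩ ∩ recType-isRec Ts

  recType-∷ : ∀ {j J} → All (λ j → IsTy (τ j)) (j ∷ J) →
              recType l τ (j ∷ J) ≐ ⟨ l j ∶ τ j ⟩ ∩ recType l τ J
  recType-∷ (T ∷ [])    = ≐-sym (field-∩-⟨⟩ T)
  recType-∷ (T ∷ _ ∷ _) = ≐-refl

  field+recType-∷ : ∀ {L σ j J} → IsTy σ → All (λ j → IsTy (τ j)) (j ∷ J) →
                    ⟨ L ∶ σ ⟩ + recType l τ (j ∷ J) ≐ ⟨ L ∶ σ ⟩ + (⟨ l j ∶ τ j ⟩ ∩ recType l τ J)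
  field+recType-∷ S Ts@(T ∷ Ts′) =
    +-congˡ ⟨ _ ∶ S ⟩ (recType-isRec Ts) (⟨ _ ∶ T ⟩ ∩ recType-isRec Ts′) (recType-∷ Ts)

  override-present : ∀ {L σ J} → IsTy σ → All (λ j → IsTy (τ j)) J →
                     Any (λ j → l j ≡ L) J → ⟨ L ∶ σ ⟩ + recType l τ J ≐ recType l τ J
  override-present {L} {σ} {j ∷ J} S Ts@(T ∷ Ts′) hit = begin
    ⟨ L ∶ σ ⟩ + recType l τ (j ∷ J)                 ≈⟨ field+recType-∷ S Ts ⟩
    ⟨ L ∶ σ ⟩ + (⟨ l j ∶ τ j ⟩ ∩ recType l τ J)     ≈⟨ push hit (l j ≟ L) ⟩
    ⟨ l j ∶ τ j ⟩ ∩ recType l τ J                   ≈⟨ recType-∷ Ts ⟨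
    recType l τ (j ∷ J)                             ∎
    where
    R = recType-isRec Ts′
    push : Any (λ j → l j ≡ L) (j ∷ J) → Dec (l j ≡ L) →
           ⟨ L ∶ σ ⟩ + (⟨ l j ∶ τ j ⟩ ∩ recType l τ J) ≐ ⟨ l j ∶ τ j ⟩ ∩ recType l τ J
    push _           (yes lj≡L) = override-same lj≡L S T R
    push (here lj≡L) (no lj≢L)  = override-same lj≡L S T R
    push (there hit) (no lj≢L)  = ≐-trans (override-diff lj≢L S T R)
      (∩-congˡ (rec ⟨ _ ∶ T ⟩) (rec (⟨ _ ∶ S ⟩ + R)) (rec R) (override-present S Ts′ hit))

  override-absent : ∀ {L σ J} → IsTy σ → All (λ j → IsTy (τ j)) J →
                    All (λ j → l j ≢ L) J → ⟨ L ∶ σ ⟩ + recType l τ J ≐ ⟨ L ∶ σ ⟩ ∩ recType l τ J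
  override-absent S [] [] = ≐-trans (+-identityʳ ⟨ _ ∶ S ⟩) (≐-sym (field-∩-⟨⟩ S))
  override-absent {L} {σ} {j ∷ J} S Ts@(T ∷ Ts′) (lj≢L ∷ miss) = begin
    ⟨ L ∶ σ ⟩ + recType l τ (j ∷ J)                 ≈⟨ field+recType-∷ S Ts ⟩
    ⟨ L ∶ σ ⟩ + (⟨ l j ∶ τ j ⟩ ∩ recType l τ J)     ≈⟨ override-diff lj≢L S T R ⟩
    ⟨ l j ∶ τ j ⟩ ∩ (⟨ L ∶ σ ⟩ + recType l τ J)     ≈⟨ ∩-congˡ F (rec (⟨ _ ∶ S ⟩ + R)) (rec ⟨ _ ∶ S ⟩ ∩ rec R)
                                                         (override-absent S Ts′ miss) ⟩
    ⟨ l j ∶ τ j ⟩ ∩ (⟨ L ∶ σ ⟩ ∩ recType l τ J)     ≈⟨ ∩-leftSwap F (rec ⟨ _ ∶ S ⟩) (rec R) ⟩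
    ⟨ L ∶ σ ⟩ ∩ (⟨ l j ∶ τ j ⟩ ∩ recType l τ J)     ≈⟨ ∩-congˡ (rec ⟨ _ ∶ S ⟩) (rec (recType-isRec Ts))
                                                         (rec (⟨ _ ∶ T ⟩ ∩ R)) (recType-∷ Ts) ⟨
    ⟨ L ∶ σ ⟩ ∩ recType l τ (j ∷ J)                 ∎
    where
    R = recType-isRec Ts′
    F = rec ⟨ _ ∶ T ⟩

-- Uniqueness of J is not needed: a repeated index only repeats a conjunct.
lemma3p6 : (l : ℕ → Label) (J : List ℕ) (j₀ : ℕ) (σ : Ty) (τ : ℕ → Ty) →
           Unique J →
           (∀ i j → i ∈ j₀ ∷ J → j ∈ j₀ ∷ J → l i ≡ l j → i ≡ j) →
           IsTy σ →
           (∀ j → j ∈ J → IsTy (τ j)) →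
           ((j₀ ∈ J → ⟨ l j₀ ∶ σ ⟩ + recType l τ J ≐ recType l τ J)
           × (j₀ ∉ J → ⟨ l j₀ ∶ σ ⟩ + recType l τ J ≐ ⟨ l j₀ ∶ σ ⟩ ∩ recType l τ J))
lemma3p6 l J j₀ σ τ _ l-injective S T =
  (λ j₀∈J → override-present l τ S Ts (Any.map (≡.cong l ∘ ≡.sym) j₀∈J)) ,
  (λ j₀∉J → override-absent l τ S Ts (All.tabulate (λ j∈J lj≡lj₀ →
     j₀∉J (≡.subst (_∈ J) (l-injective _ j₀ (there j∈J) (here ≡.refl) lj≡lj₀) j∈J))))
  where
  Ts : All (λ j → IsTy (τ j)) J
  Ts = All.tabulate (T _)
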